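{- The map $(B,\sigma)\mapsto \mathrm{SetComp}(\mathrm{Odd}(B),\sigma)$ is a bijection from the set of enriched standard pairs $(B,\sigma)$ (with $B\subseteq\{2,\dots,n-1\}$ a peak set and $\sigma\in\mathfrak S_n$) to the set of odd set compositions of $[n]$.
   Context: $[m]=\{1,\dots,m\}$, $\mathfrak S_n$ the symmetric group on $[n]$. A set composition of $[n]$ is a sequence $\phi_1|\cdots|\phi_\ell$ of pairwise disjoint nonempty sets with union $[n]$; it is odd if every block has odd size. For $A=\{a_1<\dots<a_k\}\subseteq[n-1]$ and $\sigma\in\mathfrak S_n$, $\mathrm{SetComp}(A,\sigma)=\{\sigma(1),\dots,\sigma(a_1)\}|\{\sigma(a_1+1),\dots,\sigma(a_2)\}|\cdots|\{\sigma(a_k+1),\dots,\sigma(n)\}$. A peak set is a set $B\subseteq\{2,\dots,n-1\}$ with no two consecutive integers; $\mathrm{Odd}(B)=[n-1]\setminus(B\cup(B-1))$ where $B-1=\{b-1:b\in B\}$. $\mathrm{Des}(\sigma)=\{i\in[n-1]:\sigma(i)>\sigma(i+1)\}$. A pair $(B,\sigma)$ with $B$ a peak set is enriched standard if $\mathrm{Des}(\sigma)\subseteq\mathrm{Odd}(B)$. -}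

module Defs where

open import Data.Nat using (ℕ; zero; suc; _≤_; _<?_; _%_)
open import Data.Bool using (Bool; true; false; if_then_else_; _∧_; not)
open import Data.Fin using (Fin; toℕ; fromℕ<; _<_)
open import Data.Fin.Subset using (Subset; ⁅_⁆; _∪_; _∩_; ⊥; ⊤; ∣_∣; Nonempty; _∈_)
open import Data.Fin.Permutation using (Permutation′; _⟨$⟩ʳ_)
open import Data.List using (List; []; _∷_; foldr)
open import Data.List.Relation.Unary.All using (All)
open import Data.List.Relation.Unary.AllPairs using (AllPairs)
open import Data.Vec using (lookup)
open import Data.Vec.Base using (allFin)
open import Data.Product using (_×_)
open import Relation.Binary.PropositionalEquality using (_≡_)
open import Relation.Nullary.Decidable using (yes; no)
import Data.List.Base as L
import Data.Vec.Base as V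

-- Conventions.
-- * A subset of {0,...,n-1} ⊆ ℕ is a 'Subset n'; index k stands for the
--   integer k.  So subsets of [n-1] = {1,...,n-1} are Subsets n not
--   containing 0.  'memℕ A k' tests whether the integer k lies in A
--   (false when k ≥ n).
-- * The ground set [n] = {1,...,n} is represented by Fin n, with Fin value
--   v standing for v+1 (a uniform, order-preserving relabelling).
-- * Positions 1,...,n of a permutation are likewise Fin n (position i is
--   the Fin element with toℕ = i-1), and σ(i) = σ ⟨$⟩ʳ (i-1).

memℕ : ∀ {n} → Subset n → ℕ → Bool
memℕ {n} A k with k <? n
... | yes k<n = lookup A (fromℕ< k<n)
... | no _ = false

PeakSet : ∀ {n} → Subset n → Set
PeakSet {n} B =
  (∀ k → memℕ B k ≡ true → 2 ≤ k) ×
  (∀ k → memℕ B k ≡ true → memℕ B (suc k) ≡ false)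

-- Odd(B) = [n-1] \ (B ∪ (B - 1)), as a subset of {0,...,n-1}.
OddSet : ∀ {n} → Subset n → Subset n
OddSet {n} B = V.map f (allFin n)
  where
  f : Fin n → Bool
  f i with toℕ i
  ... | zero = false
  ... | suc j = not (memℕ B (suc j)) ∧ not (memℕ B (suc (suc j)))

-- Des(σ) ⊆ A : whenever σ(i) > σ(i+1) (1 ≤ i ≤ n-1), i ∈ A.
-- Position i is the Fin element p (toℕ p = i-1), position i+1 is q.
DesSubset : ∀ {n} → Permutation′ n → Subset n → Set
DesSubset {n} σ A =
  (p q : Fin n) → toℕ q ≡ suc (toℕ p) →
  (σ ⟨$⟩ʳ q) < (σ ⟨$⟩ʳ p) → memℕ A (suc (toℕ p)) ≡ true

EnrichedStandard : ∀ {n} → Subset n → Permutation′ n → Set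
EnrichedStandard B σ = PeakSet B × DesSubset σ (OddSet B)

setCompGo : ∀ {n} → Subset n → Permutation′ n → List (Fin n) → Subset n → List (Subset n)
setCompGo A σ [] cur = cur ∷ []
setCompGo A σ (p ∷ ps) cur =
  if memℕ A (suc (toℕ p))
  then (cur ∪ ⁅ σ ⟨$⟩ʳ p ⁆) ∷ setCompGo A σ ps ⊥
  else setCompGo A σ ps (cur ∪ ⁅ σ ⟨$⟩ʳ p ⁆)

SetComp : ∀ {n} → Subset n → Permutation′ n → List (Subset n)
SetComp {n} A σ = setCompGo A σ (V.toList (allFin n)) ⊥

IsSetComposition : ∀ {n} → List (Subset n) → Set
IsSetComposition Φ =
  All Nonempty Φ ×
  AllPairs (λ a b → a ∩ b ≡ ⊥) Φ ×
  foldr _∪_ ⊥ Φ ≡ ⊤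

IsOddSetComposition : ∀ {n} → List (Subset n) → Set
IsOddSetComposition Φ = IsSetComposition Φ × All (λ b → ∣ b ∣ % 2 ≡ 1) Φ

-- Record the word together
-- with one cut flag per position. For a peak set B the flags of Odd(B) cut the word into blocks of
-- odd length: a block grows by two exactly where a peak b makes b - 1 and b non-cuts, and every
-- sequence of cuts into odd blocks arises from exactly one peak set. Des(σ) ⊆ Odd(B) says that σ
-- increases inside every block. So enriched standard pairs correspond to words cut into odd
-- increasing blocks that together enumerate [n], and these correspond to odd set compositions,
-- since a set has exactly one increasing enumeration.

module Submission where

open import Defs
open import Data.Bool using (Bool; true; false; not; _∧_)
open import Data.Bool.Properties using (¬-not)
open import Data.Empty using (⊥-elim)
open import Data.Fin as Fin using (Fin; zero; suc; toℕ; fromℕ<; cast; _<_)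
import Data.Fin.Properties as Fin
open import Data.Fin.Permutation using (Permutation′; _⟨$⟩ʳ_; _⟨$⟩ˡ_; inverseˡ; inverseʳ; permutation)
open import Data.Fin.Subset using (Subset; ⁅_⁆; _∪_; _∩_; ⊥; ⊤; ∣_∣; ⋃; _∈_; _∉_; inside; outside; Nonempty)
open import Data.Fin.Subset.Properties using (_∈?_; ∪-identityʳ; p⊆p∪q; q⊆p∪q; x∈p∪q⁻;
  x∈⁅x⁆; x∈⁅y⁆⇒x≡y; ∉⊥; ∈⊤; ∣⊥∣≡0; ∣⊤∣≡n; ⊆-antisym; Empty-unique; x∈p∩q⁻; x∈p∩q⁺)
open import Data.List using (List; []; _∷_; _++_; map; concat; length; filter; allFin; lookup; tabulate)
open import Data.List.NonEmpty using (List⁺; _∷_; head; tail; toList)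
open import Data.List.Membership.Propositional using () renaming (_∈_ to _∈ₗ_)
open import Data.List.Membership.Propositional.Properties using (∈-filter⁺; ∈-filter⁻; ∈-allFin; ∈-++⁺ʳ;
  ∈-concat⁺; ∈-concat⁺′; ∈-concat⁻; ∈-tabulate⁺; ∈-lookup)
open import Data.List.Properties
  using (∷-injectiveˡ; ∷-injectiveʳ; map-tabulate; length-map; tabulate-cong; tabulate-lookup)
open import Data.List.Relation.Binary.Disjoint.Propositional using (Disjoint)
open import Data.List.Relation.Unary.All as All using (All; []; _∷_)
import Data.List.Relation.Unary.All.Properties as All
open import Data.List.Relation.Unary.AllPairs as AllPairs using (AllPairs; []; _∷_)
import Data.List.Relation.Unary.AllPairs.Properties as AllPairs
open import Data.List.Relation.Unary.Any as Any using (Any; here; there; index)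
import Data.List.Relation.Unary.Any.Properties as Any
open import Data.List.Relation.Unary.Linked as Linked using (Linked; []; [-]; _∷_)
import Data.List.Relation.Unary.Linked.Properties as Linked
open import Data.List.Relation.Unary.Unique.Propositional using (Unique)
import Data.List.Relation.Unary.Unique.Propositional.Properties as Unique
open import Data.Nat as ℕ using (ℕ; zero; suc; _+_; _%_; _≤_; z≤n; s≤s)
import Data.Nat.Properties as ℕ
open import Data.Product using (_×_; _,_; proj₁; proj₂; ∃-syntax)
open import Data.Sum using (_⊎_; inj₁; inj₂; [_,_]′)
open import Data.Vec as Vec using (Vec; []; _∷_)
import Data.Vec.Properties as Vec
open import Function using (_∘_)
open import Relation.Binary.Core using (Rel)
open import Relation.Binary.Definitions using (tri<; tri≈; tri>)
open import Relation.Nullary using (yes; no)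
open import Relation.Binary.PropositionalEquality
  using (_≡_; _≢_; refl; sym; trans; cong; cong₂; subst; module ≡-Reasoning)
open ≡-Reasoning

private variable
  A : Set
  b : Bool
  k m n : ℕ

-- Cutting a flagged word into blocks

blocks : List (Bool × A) → List⁺ (List A)
blocks [] = [] ∷ []
blocks ((true , x) ∷ ps) = (x ∷ []) ∷ toList (blocks ps)
blocks ((false , x) ∷ ps) = (x ∷ head (blocks ps)) ∷ tail (blocks ps)

unblocks : List⁺ (List A) → List (Bool × A)
unblocks (c ∷ cs) = go c cs
  where
  go : List A → List (List A) → List (Bool × A)
  go [] _ = []
  go (x ∷ []) [] = (false , x) ∷ []
  go (x ∷ []) (c ∷ cs) = (true , x) ∷ go c cs
  go (x ∷ y ∷ c) cs = (false , x) ∷ go (y ∷ c) cs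

unblocks-blocks : (ps : List (Bool × A)) → unblocks (blocks ps) ≡ ps
unblocks-blocks [] = refl
unblocks-blocks ((true , x) ∷ ps) = cong ((true , x) ∷_) (unblocks-blocks ps)
unblocks-blocks ((false , x) ∷ []) = refl
unblocks-blocks ((false , x) ∷ ps@((true , _) ∷ _)) = cong ((false , x) ∷_) (unblocks-blocks ps)
unblocks-blocks ((false , x) ∷ ps@((false , _) ∷ _)) = cong ((false , x) ∷_) (unblocks-blocks ps)

blocks-injective : (ps qs : List (Bool × A)) → toList (blocks ps) ≡ toList (blocks qs) → ps ≡ qs
blocks-injective ps qs eq = begin
  ps                     ≡⟨ sym (unblocks-blocks ps) ⟩
  unblocks (blocks ps)   ≡⟨ cong unblocks (cong₂ _∷_ (∷-injectiveˡ eq) (∷-injectiveʳ eq)) ⟩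
  unblocks (blocks qs)   ≡⟨ unblocks-blocks qs ⟩
  qs                     ∎

blocks-unblocks : (c : List A) (cs : List (List A)) → All (_≢ []) (c ∷ cs) →
                  blocks (unblocks (c ∷ cs)) ≡ c ∷ cs
blocks-unblocks [] _ (c≢[] ∷ _) = ⊥-elim (c≢[] refl)
blocks-unblocks (x ∷ []) [] _ = refl
blocks-unblocks (x ∷ []) (c ∷ cs) (_ ∷ nonempty) =
  cong (λ l → (x ∷ []) ∷ toList l) (blocks-unblocks c cs nonempty)
blocks-unblocks (x ∷ y ∷ c) cs (_ ∷ nonempty) =
  cong (λ l → (x ∷ head l) ∷ tail l) (blocks-unblocks (y ∷ c) cs ((λ ()) ∷ nonempty))

concat-blocks : (ps : List (Bool × A)) → concat (toList (blocks ps)) ≡ map proj₂ ps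
concat-blocks [] = refl
concat-blocks ((true , x) ∷ ps) = cong (x ∷_) (concat-blocks ps)
concat-blocks ((false , x) ∷ ps) = cong (x ∷_) (concat-blocks ps)

map-proj₂-unblocks : (c : List A) (cs : List (List A)) → All (_≢ []) (c ∷ cs) →
                     map proj₂ (unblocks (c ∷ cs)) ≡ concat (c ∷ cs)
map-proj₂-unblocks c cs nonempty =
  trans (sym (concat-blocks (unblocks (c ∷ cs)))) (cong (concat ∘ toList) (blocks-unblocks c cs nonempty))

Odd : List A → Set
Odd xs = length xs % 2 ≡ 1

odd⇒≢[] : {xs : List A} → Odd xs → xs ≢ []
odd⇒≢[] {xs = x ∷ _} _ ()

data OddCuts : List Bool → Set where
  end    : OddCuts (false ∷ [])
  cut    : ∀ {fs} → OddCuts fs → OddCuts (true ∷ fs)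
  extend : ∀ {fs} → OddCuts fs → OddCuts (false ∷ false ∷ fs)

blocks-odd : (ps : List (Bool × A)) → OddCuts (map proj₁ ps) → All Odd (toList (blocks ps))
blocks-odd ((false , x) ∷ []) end = refl ∷ []
blocks-odd ((true , x) ∷ ps) (cut c) = refl ∷ blocks-odd ps c
blocks-odd ((false , x) ∷ (false , y) ∷ ps) (extend c) with blocks-odd ps c
... | odd ∷ odds = odd ∷ odds

unblocks-oddCuts : (c : List A) (cs : List (List A)) → All Odd (c ∷ cs) →
                   OddCuts (map proj₁ (unblocks (c ∷ cs)))
unblocks-oddCuts [] _ (() ∷ _)
unblocks-oddCuts (x ∷ []) [] _ = end
unblocks-oddCuts (x ∷ []) (c ∷ cs) (_ ∷ odds) = cut (unblocks-oddCuts c cs odds)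
unblocks-oddCuts (x ∷ y ∷ z ∷ c) cs (odd ∷ odds) = extend (unblocks-oddCuts (z ∷ c) cs (odd ∷ odds))

WithinBlock : ∀ {ℓ} → Rel A ℓ → Rel (Bool × A) ℓ
WithinBlock R (c , x) (_ , y) = c ≡ false → R x y

module _ {ℓ} {R : Rel A ℓ} where

  blocks-linked : (ps : List (Bool × A)) → Linked (WithinBlock R) ps → All (Linked R) (toList (blocks ps))
  blocks-linked [] [] = [] ∷ []
  blocks-linked ((true , x) ∷ ps) l = [-] ∷ blocks-linked ps (Linked.tail l)
  blocks-linked ((false , x) ∷ []) [-] = [-] ∷ []
  blocks-linked ((false , x) ∷ (true , y) ∷ ps) (r ∷ l) with blocks-linked _ l
  ... | _ ∷ rest = (r refl ∷ [-]) ∷ rest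
  blocks-linked ((false , x) ∷ (false , y) ∷ ps) (r ∷ l) with blocks-linked _ l
  ... | first ∷ rest = (r refl ∷ first) ∷ rest

  cut-linked : ∀ {x} ps → Linked (WithinBlock R) ps → Linked (WithinBlock R) ((true , x) ∷ ps)
  cut-linked [] _ = [-]
  cut-linked (_ ∷ _) l = (λ ()) ∷ l

  unblocks-linked : (c : List A) (cs : List (List A)) → All (Linked R) (c ∷ cs) →
                    Linked (WithinBlock R) (unblocks (c ∷ cs))
  unblocks-linked [] _ _ = []
  unblocks-linked (x ∷ []) [] _ = [-]
  unblocks-linked (x ∷ []) (c ∷ cs) (_ ∷ ls) = cut-linked _ (unblocks-linked c cs ls)
  unblocks-linked (x ∷ y ∷ []) [] ((r ∷ _) ∷ _) = (λ _ → r) ∷ [-]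
  unblocks-linked (x ∷ y ∷ []) (c ∷ cs) ((r ∷ l) ∷ ls) =
    (λ _ → r) ∷ unblocks-linked (y ∷ []) (c ∷ cs) (l ∷ ls)
  unblocks-linked (x ∷ y ∷ z ∷ c) cs ((r ∷ l) ∷ ls) =
    (λ _ → r) ∷ unblocks-linked (y ∷ z ∷ c) cs (l ∷ ls)

  Linked-tabulate⁺ : (f : Fin n → A) → (∀ p q → toℕ q ≡ suc (toℕ p) → R (f p) (f q)) →
                     Linked R (tabulate f)
  Linked-tabulate⁺ {zero} f _ = []
  Linked-tabulate⁺ {suc zero} f _ = [-]
  Linked-tabulate⁺ {suc (suc n)} f adjacent =
    adjacent zero (suc zero) refl ∷ Linked-tabulate⁺ (f ∘ suc) (λ p q eq → adjacent (suc p) (suc q) (cong suc eq))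

  Linked-tabulate⁻ : (f : Fin n → A) → Linked R (tabulate f) →
                     ∀ p q → toℕ q ≡ suc (toℕ p) → R (f p) (f q)
  Linked-tabulate⁻ f _ zero zero ()
  Linked-tabulate⁻ f _ zero (suc (suc q)) ()
  Linked-tabulate⁻ f _ (suc p) zero ()
  Linked-tabulate⁻ {suc (suc n)} f (r ∷ _) zero (suc zero) refl = r
  Linked-tabulate⁻ {suc (suc n)} f (_ ∷ l) (suc p) (suc q) eq =
    Linked-tabulate⁻ (f ∘ suc) l p q (ℕ.suc-injective eq)

-- Lists and subsets of Fin n

addAll : Subset n → List (Fin n) → Subset n
addAll s [] = s
addAll s (x ∷ xs) = addAll (s ∪ ⁅ x ⁆) xs

toSubset : List (Fin n) → Subset n
toSubset = addAll ⊥

∈-addAll⁺ˡ : ∀ {x s} (xs : List (Fin n)) → x ∈ s → x ∈ addAll s xs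
∈-addAll⁺ˡ [] x∈s = x∈s
∈-addAll⁺ˡ (y ∷ xs) x∈s = ∈-addAll⁺ˡ xs (p⊆p∪q ⁅ y ⁆ x∈s)

∈-addAll⁺ʳ : ∀ {x} s (xs : List (Fin n)) → x ∈ₗ xs → x ∈ addAll s xs
∈-addAll⁺ʳ s (y ∷ xs) (here refl) = ∈-addAll⁺ˡ xs (q⊆p∪q s ⁅ y ⁆ (x∈⁅x⁆ y))
∈-addAll⁺ʳ s (y ∷ xs) (there x∈xs) = ∈-addAll⁺ʳ (s ∪ ⁅ y ⁆) xs x∈xs

∈-addAll⁻ : ∀ {x} s (xs : List (Fin n)) → x ∈ addAll s xs → x ∈ s ⊎ x ∈ₗ xs
∈-addAll⁻ s [] x∈s = inj₁ x∈s
∈-addAll⁻ s (y ∷ xs) x∈ with ∈-addAll⁻ (s ∪ ⁅ y ⁆) xs x∈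
... | inj₂ x∈xs = inj₂ (there x∈xs)
... | inj₁ x∈s∪y = [ inj₁ , inj₂ ∘ here ∘ x∈⁅y⁆⇒x≡y y ]′ (x∈p∪q⁻ s ⁅ y ⁆ x∈s∪y)

∈-toSubset⁺ : ∀ {x} {xs : List (Fin n)} → x ∈ₗ xs → x ∈ toSubset xs
∈-toSubset⁺ = ∈-addAll⁺ʳ ⊥ _

∈-toSubset⁻ : ∀ {x} {xs : List (Fin n)} → x ∈ toSubset xs → x ∈ₗ xs
∈-toSubset⁻ {xs = xs} x∈ = [ ⊥-elim ∘ ∉⊥ , (λ x∈xs → x∈xs) ]′ (∈-addAll⁻ ⊥ xs x∈)

∣p∪⁅x⁆∣≡1+∣p∣ : ∀ (p : Subset n) x → x ∉ p → ∣ p ∪ ⁅ x ⁆ ∣ ≡ suc ∣ p ∣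
∣p∪⁅x⁆∣≡1+∣p∣ (outside ∷ p) zero _ = cong (suc ∘ ∣_∣) (∪-identityʳ p)
∣p∪⁅x⁆∣≡1+∣p∣ (inside ∷ p) zero x∉p = ⊥-elim (x∉p Vec.here)
∣p∪⁅x⁆∣≡1+∣p∣ (outside ∷ p) (suc x) x∉p = ∣p∪⁅x⁆∣≡1+∣p∣ p x (x∉p ∘ Vec.there)
∣p∪⁅x⁆∣≡1+∣p∣ (inside ∷ p) (suc x) x∉p = cong suc (∣p∪⁅x⁆∣≡1+∣p∣ p x (x∉p ∘ Vec.there))

∣addAll∣ : ∀ s (xs : List (Fin n)) → Unique xs → All (_∉ s) xs → ∣ addAll s xs ∣ ≡ ∣ s ∣ + length xs
∣addAll∣ s [] _ _ = sym (ℕ.+-identityʳ ∣ s ∣)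
∣addAll∣ s (x ∷ xs) (x∉xs ∷ unique) (x∉s ∷ xs∉s) = begin
  ∣ addAll (s ∪ ⁅ x ⁆) xs ∣   ≡⟨ ∣addAll∣ (s ∪ ⁅ x ⁆) xs unique (All.zipWith fresh (x∉xs , xs∉s)) ⟩
  ∣ s ∪ ⁅ x ⁆ ∣ + length xs  ≡⟨ cong (_+ length xs) (∣p∪⁅x⁆∣≡1+∣p∣ s x x∉s) ⟩
  suc (∣ s ∣ + length xs)    ≡⟨ sym (ℕ.+-suc ∣ s ∣ (length xs)) ⟩
  ∣ s ∣ + suc (length xs)    ∎
  where
  fresh : ∀ {y} → x ≢ y × y ∉ s → y ∉ s ∪ ⁅ x ⁆
  fresh (x≢y , y∉s) y∈ = [ y∉s , x≢y ∘ sym ∘ x∈⁅y⁆⇒x≡y x ]′ (x∈p∪q⁻ s ⁅ x ⁆ y∈)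

∣toSubset∣ : (xs : List (Fin n)) → Unique xs → ∣ toSubset xs ∣ ≡ length xs
∣toSubset∣ {n} xs unique =
  trans (∣addAll∣ ⊥ xs unique (All.tabulate (λ _ → ∉⊥))) (cong (_+ length xs) (∣⊥∣≡0 n))

length-enumeration : (w : List (Fin n)) → Unique w → (∀ x → x ∈ₗ w) → length w ≡ n
length-enumeration {n} w unique complete = begin
  length w          ≡⟨ sym (∣toSubset∣ w unique) ⟩
  ∣ toSubset w ∣    ≡⟨ cong ∣_∣ (⊆-antisym (λ _ → ∈⊤) (λ {x} _ → ∈-toSubset⁺ (complete x))) ⟩
  ∣ ⊤ {n} ∣         ≡⟨ ∣⊤∣≡n n ⟩
  n                 ∎

∈-⋃⁺ : ∀ {x} (Φ : List (Subset n)) → Any (x ∈_) Φ → x ∈ ⋃ Φ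
∈-⋃⁺ (φ ∷ Φ) (here x∈φ) = p⊆p∪q (⋃ Φ) x∈φ
∈-⋃⁺ (φ ∷ Φ) (there x∈Φ) = q⊆p∪q φ (⋃ Φ) (∈-⋃⁺ Φ x∈Φ)

∈-⋃⁻ : ∀ {x} (Φ : List (Subset n)) → x ∈ ⋃ Φ → Any (x ∈_) Φ
∈-⋃⁻ [] x∈⊥ = ⊥-elim (∉⊥ x∈⊥)
∈-⋃⁻ (φ ∷ Φ) x∈ = [ here , there ∘ ∈-⋃⁻ Φ ]′ (x∈p∪q⁻ φ (⋃ Φ) x∈)

⋃-covers : (Φ : List (Subset n)) → (∀ x → Any (x ∈_) Φ) → ⋃ Φ ≡ ⊤
⋃-covers Φ covers = ⊆-antisym (λ _ → ∈⊤) (λ {x} _ → ∈-⋃⁺ Φ (covers x))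

toSubset-disjoint : {xs ys : List (Fin n)} → Disjoint xs ys → toSubset xs ∩ toSubset ys ≡ ⊥
toSubset-disjoint {xs = xs} {ys} disjoint = Empty-unique λ (x , x∈) →
  let x∈xs , x∈ys = x∈p∩q⁻ (toSubset xs) (toSubset ys) x∈
  in disjoint (∈-toSubset⁻ x∈xs , ∈-toSubset⁻ x∈ys)

Unique-++⁻ : (xs ys : List A) → Unique (xs ++ ys) → Unique xs × Unique ys × Disjoint xs ys
Unique-++⁻ [] ys unique = [] , unique , λ ()
Unique-++⁻ (x ∷ xs) ys (x∉ ∷ unique) =
  let uxs , uys , disjoint = Unique-++⁻ xs ys unique
  in All.++⁻ˡ xs x∉ ∷ uxs , uys , λ where
       (here refl , x∈ys) → All.lookup x∉ (∈-++⁺ʳ xs x∈ys) refl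
       (there z∈xs , z∈ys) → disjoint (z∈xs , z∈ys)

Unique-concat⁻ : (xss : List (List A)) → Unique (concat xss) → All Unique xss × AllPairs Disjoint xss
Unique-concat⁻ [] _ = [] , []
Unique-concat⁻ (xs ∷ xss) unique =
  let uxs , uxss , disjoint = Unique-++⁻ xs (concat xss) unique
      us , ds = Unique-concat⁻ xss uxss
  in uxs ∷ us , All.tabulate (λ ys∈ (z∈xs , z∈ys) → disjoint (z∈xs , ∈-concat⁺′ z∈ys ys∈)) ∷ ds

toSubsets-isOddSetComposition : (ss : List (List (Fin n))) → Unique (concat ss) → (∀ x → x ∈ₗ concat ss) →
                                All Odd ss → IsOddSetComposition (map toSubset ss)
toSubsets-isOddSetComposition ss unique covers odds =
  (All.map⁺ (All.map (λ {s} → nonempty {s}) odds) ,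
   AllPairs.map⁺ (AllPairs.map toSubset-disjoint (proj₂ (Unique-concat⁻ ss unique))) ,
   ⋃-covers (map toSubset ss) (λ x → Any.map⁺ (Any.map ∈-toSubset⁺ (∈-concat⁻ ss (covers x))))) ,
  All.map⁺ (All.zipWith (λ {s} → oddSize {s}) (proj₁ (Unique-concat⁻ ss unique) , odds))
  where
  nonempty : ∀ {s} → Odd s → Nonempty (toSubset s)
  nonempty {x ∷ xs} _ = x , ∈-toSubset⁺ {xs = x ∷ xs} (here refl)
  oddSize : ∀ {s} → Unique s × Odd s → ∣ toSubset s ∣ % 2 ≡ 1
  oddSize {s} (unique , odd) = trans (cong (_% 2) (∣toSubset∣ s unique)) odd

allFin-increasing : ∀ n → Linked _<_ (allFin n)
allFin-increasing n = Linked-tabulate⁺ (λ i → i) (λ p q eq → ℕ.≤-reflexive (sym eq))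

elements : Subset n → List (Fin n)
elements φ = filter (_∈? φ) (allFin _)

∈-elements⁺ : ∀ {φ : Subset n} {x} → x ∈ φ → x ∈ₗ elements φ
∈-elements⁺ {φ = φ} x∈φ = ∈-filter⁺ (_∈? φ) (∈-allFin _) x∈φ

∈-elements⁻ : ∀ {φ : Subset n} {x} → x ∈ₗ elements φ → x ∈ φ
∈-elements⁻ {φ = φ} x∈ = proj₂ (∈-filter⁻ (_∈? φ) {xs = allFin _} x∈)

elements-increasing : (φ : Subset n) → Linked _<_ (elements φ)
elements-increasing φ = Linked.filter⁺ (_∈? φ) Fin.<-trans (allFin-increasing _)

elements-unique : (φ : Subset n) → Unique (elements φ)
elements-unique φ = AllPairs.map Fin.<⇒≢ (Linked.Linked⇒AllPairs Fin.<-trans (elements-increasing φ))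

toSubset-elements : (φ : Subset n) → toSubset (elements φ) ≡ φ
toSubset-elements φ = ⊆-antisym (∈-elements⁻ ∘ ∈-toSubset⁻) (∈-toSubset⁺ ∘ ∈-elements⁺)

map-toSubset-elements : (Φ : List (Subset n)) → map toSubset (map elements Φ) ≡ Φ
map-toSubset-elements [] = refl
map-toSubset-elements (φ ∷ Φ) = cong₂ _∷_ (toSubset-elements φ) (map-toSubset-elements Φ)

length-elements : (φ : Subset n) → length (elements φ) ≡ ∣ φ ∣
length-elements φ = trans (sym (∣toSubset∣ (elements φ) (elements-unique φ))) (cong ∣_∣ (toSubset-elements φ))

elements-isOddSetComposition : (Φ : List (Subset n)) → IsOddSetComposition Φ →
  Unique (concat (map elements Φ)) × (∀ x → x ∈ₗ concat (map elements Φ)) × All Odd (map elements Φ)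
elements-isOddSetComposition Φ ((_ , disjoint , ⋃Φ≡⊤) , odds) =
  Unique.concat⁺ (All.map⁺ (All.universal elements-unique Φ))
    (AllPairs.map⁺ (AllPairs.map elements-disjoint disjoint)) ,
  (λ x → ∈-concat⁺ (Any.map⁺ (Any.map ∈-elements⁺ (∈-⋃⁻ Φ (subst (x ∈_) (sym ⋃Φ≡⊤) ∈⊤))))) ,
  All.map⁺ (All.map (λ {φ} odd → trans (cong (_% 2) (length-elements φ)) odd) odds)
  where
  elements-disjoint : ∀ {φ ψ : Subset n} → φ ∩ ψ ≡ ⊥ → Disjoint (elements φ) (elements ψ)
  elements-disjoint φ∩ψ≡⊥ (x∈φ , x∈ψ) =
    ∉⊥ (subst (_ ∈_) φ∩ψ≡⊥ (x∈p∩q⁺ (∈-elements⁻ x∈φ , ∈-elements⁻ x∈ψ)))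

increasing-head< : ∀ {x z} {xs : List (Fin n)} → Linked _<_ (x ∷ xs) → z ∈ₗ xs → x < z
increasing-head< l = All.lookup (AllPairs.head (Linked.Linked⇒AllPairs Fin.<-trans l))

increasing-≡ : {xs ys : List (Fin n)} → Linked _<_ xs → Linked _<_ ys →
               (∀ {z} → z ∈ₗ xs → z ∈ₗ ys) → (∀ {z} → z ∈ₗ ys → z ∈ₗ xs) → xs ≡ ys
increasing-≡ {xs = []} {[]} _ _ _ _ = refl
increasing-≡ {xs = []} {_ ∷ _} _ _ _ ys⊆xs with () ← ys⊆xs (here refl)
increasing-≡ {xs = _ ∷ _} {[]} _ _ xs⊆ys _ with () ← xs⊆ys (here refl)
increasing-≡ {xs = x ∷ xs} {y ∷ ys} lx ly xs⊆ys ys⊆xs =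
  cong₂ _∷_ x≡y (increasing-≡ (Linked.tail lx) (Linked.tail ly) (tail-⊆ lx x≡y xs⊆ys) (tail-⊆ ly (sym x≡y) ys⊆xs))
  where
  x≡y : x ≡ y
  x≡y with xs⊆ys (here refl) | ys⊆xs (here refl)
  ... | here x≡y | _ = x≡y
  ... | there _ | here y≡x = sym y≡x
  ... | there x∈ys | there y∈xs = ⊥-elim (Fin.<-asym (increasing-head< ly x∈ys) (increasing-head< lx y∈xs))
  tail-⊆ : ∀ {u v us vs} → Linked _<_ (u ∷ us) → u ≡ v →
           (∀ {z} → z ∈ₗ u ∷ us → z ∈ₗ v ∷ vs) → ∀ {z} → z ∈ₗ us → z ∈ₗ vs
  tail-⊆ lu u≡v ⊆ z∈us with ⊆ (there z∈us)
  ... | there z∈vs = z∈vs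
  ... | here z≡v = ⊥-elim (Fin.<-irrefl (trans u≡v (sym z≡v)) (increasing-head< lu z∈us))

toSubset-injective : {xs ys : List (Fin n)} → Linked _<_ xs → Linked _<_ ys → toSubset xs ≡ toSubset ys → xs ≡ ys
toSubset-injective lx ly eq = increasing-≡ lx ly
  (λ z∈ → ∈-toSubset⁻ (subst (_ ∈_) eq (∈-toSubset⁺ z∈)))
  (λ z∈ → ∈-toSubset⁻ (subst (_ ∈_) (sym eq) (∈-toSubset⁺ z∈)))

map-toSubset-injective : {xss yss : List (List (Fin n))} → All (Linked _<_) xss → All (Linked _<_) yss →
                         map toSubset xss ≡ map toSubset yss → xss ≡ yss
map-toSubset-injective {xss = []} {[]} _ _ _ = refl
map-toSubset-injective {xss = _ ∷ _} {_ ∷ _} (lx ∷ lxs) (ly ∷ lys) eq =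
  cong₂ _∷_ (toSubset-injective lx ly (∷-injectiveˡ eq)) (map-toSubset-injective lxs lys (∷-injectiveʳ eq))

-- Permutations as words

tabulate-injective : {f g : Fin n → A} → tabulate f ≡ tabulate g → ∀ i → f i ≡ g i
tabulate-injective {suc n} eq zero = ∷-injectiveˡ eq
tabulate-injective {suc n} eq (suc i) = tabulate-injective (∷-injectiveʳ eq) i

tabulate-lookup-cast : (xs : List A) (eq : n ≡ length xs) → tabulate (lookup xs ∘ cast eq) ≡ xs
tabulate-lookup-cast xs refl = trans (tabulate-cong (cong (lookup xs) ∘ Fin.cast-is-id refl)) (tabulate-lookup xs)

lookup-injective : (xs : List A) → Unique xs → ∀ i j → lookup xs i ≡ lookup xs j → i ≡ j
lookup-injective (x ∷ xs) _ zero zero _ = refl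
lookup-injective (x ∷ xs) (x∉ ∷ _) zero (suc j) eq = ⊥-elim (All.lookup x∉ (∈-lookup j) eq)
lookup-injective (x ∷ xs) (x∉ ∷ _) (suc i) zero eq = ⊥-elim (All.lookup x∉ (∈-lookup i) (sym eq))
lookup-injective (x ∷ xs) (_ ∷ unique) (suc i) (suc j) eq = cong suc (lookup-injective xs unique i j eq)

word : Permutation′ n → List (Fin n)
word σ = tabulate (σ ⟨$⟩ʳ_)

⟨$⟩ʳ-injective : (σ : Permutation′ n) {i j : Fin n} → σ ⟨$⟩ʳ i ≡ σ ⟨$⟩ʳ j → i ≡ j
⟨$⟩ʳ-injective σ eq = trans (sym (inverseˡ σ)) (trans (cong (σ ⟨$⟩ˡ_) eq) (inverseˡ σ))

word-unique : (σ : Permutation′ n) → Unique (word σ)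
word-unique σ = Unique.tabulate⁺ (⟨$⟩ʳ-injective σ)

∈-word : (σ : Permutation′ n) → ∀ x → x ∈ₗ word σ
∈-word σ x = subst (_∈ₗ word σ) (inverseʳ σ) (∈-tabulate⁺ (σ ⟨$⟩ˡ x))

word-injective : {σ σ′ : Permutation′ n} → word σ ≡ word σ′ → ∀ i → σ ⟨$⟩ʳ i ≡ σ′ ⟨$⟩ʳ i
word-injective = tabulate-injective

word-surjective : (w : List (Fin n)) → Unique w → (∀ x → x ∈ₗ w) → ∃[ σ ] word σ ≡ w
word-surjective {n} w unique complete =
  permutation to from to∘from from∘to , tabulate-lookup-cast w (sym len)
  where
  len : length w ≡ n
  len = length-enumeration w unique complete
  to : Fin n → Fin n
  to i = lookup w (cast (sym len) i)
  from : Fin n → Fin n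
  from x = cast len (index (complete x))
  to∘from : ∀ x → to (from x) ≡ x
  to∘from x = trans (cong (lookup w) (Fin.cast-involutive (sym len) len _)) (sym (Any.lookup-index (complete x)))
  from∘to : ∀ i → from (to i) ≡ i
  from∘to i = trans (cong (cast len) (lookup-injective w unique _ _ (sym (Any.lookup-index (complete (to i))))))
                    (Fin.cast-involutive len (sym len) i)

-- Peak sets and the flags of Odd(B)

memℕ-lookup : (v : Vec Bool n) (k<n : k ℕ.< n) → memℕ v k ≡ Vec.lookup v (fromℕ< k<n)
memℕ-lookup {n} {k} v k<n with k ℕ.<? n
... | yes _ = refl
... | no k≮n = ⊥-elim (k≮n k<n)

memℕ-≥ : (v : Vec Bool n) → n ≤ k → memℕ v k ≡ false
memℕ-≥ {n} {k} v n≤k with k ℕ.<? n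
... | yes k<n = ⊥-elim (ℕ.<⇒≱ k<n n≤k)
... | no _ = refl

memℕ-zero : (v : Vec Bool n) → memℕ (b ∷ v) 0 ≡ b
memℕ-zero v = memℕ-lookup (_ ∷ v) (s≤s z≤n)

memℕ-suc : (v : Vec Bool n) → memℕ (b ∷ v) (suc k) ≡ memℕ v k
memℕ-suc {n} {k = k} v with ℕ.<-≤-connex k n
... | inj₁ k<n = trans (memℕ-lookup (_ ∷ v) (s≤s k<n)) (sym (memℕ-lookup v k<n))
... | inj₂ n≤k = trans (memℕ-≥ (_ ∷ v) (s≤s n≤k)) (sym (memℕ-≥ v n≤k))

NoConsecutive : Vec Bool n → Set
NoConsecutive v = ∀ k → memℕ v k ≡ true → memℕ v (suc k) ≡ false

noConsecutive-∷⁺ : (v : Vec Bool n) → (b ≡ true → memℕ v 0 ≡ false) → NoConsecutive v → NoConsecutive (b ∷ v)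
noConsecutive-∷⁺ v b⇒ _ zero b≡true = trans (memℕ-suc v) (b⇒ (trans (sym (memℕ-zero v)) b≡true))
noConsecutive-∷⁺ v _ noConsecutive (suc k) vₖ≡true =
  trans (memℕ-suc v) (noConsecutive k (trans (sym (memℕ-suc v)) vₖ≡true))

noConsecutive-∷⁻ : (v : Vec Bool n) → NoConsecutive (b ∷ v) → (b ≡ true → memℕ v 0 ≡ false) × NoConsecutive v
noConsecutive-∷⁻ v noConsecutive =
  (λ b≡true → trans (sym (memℕ-suc v)) (noConsecutive 0 (trans (memℕ-zero v) b≡true))) ,
  (λ k vₖ≡true → trans (sym (memℕ-suc v)) (noConsecutive (suc k) (trans (memℕ-suc v) vₖ≡true)))

data Spaced : Vec Bool n → Set where
  []   : Spaced []
  gap  : {v : Vec Bool n} → Spaced v → Spaced (false ∷ v)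
  peak : {v : Vec Bool n} → Spaced v → Spaced (false ∷ true ∷ v)

spaced⁻ : {v : Vec Bool n} → Spaced v → memℕ v 0 ≡ false × NoConsecutive v
spaced⁻ [] = memℕ-≥ {k = 0} [] z≤n , λ k _ → memℕ-≥ {k = suc k} [] z≤n
spaced⁻ (gap {v = v} s) = memℕ-zero v , noConsecutive-∷⁺ v (λ ()) (proj₂ (spaced⁻ s))
spaced⁻ (peak {v = v} s) =
  memℕ-zero (true ∷ v) ,
  noConsecutive-∷⁺ (true ∷ v) (λ ()) (noConsecutive-∷⁺ v (λ _ → proj₁ (spaced⁻ s)) (proj₂ (spaced⁻ s)))

spaced⁺ : (v : Vec Bool n) → memℕ v 0 ≡ false → NoConsecutive v → Spaced v
spaced⁺ [] _ _ = []
spaced⁺ (true ∷ v) v₀≡false _ with () ← trans (sym (memℕ-zero v)) v₀≡false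
spaced⁺ (false ∷ []) _ _ = gap []
spaced⁺ (false ∷ false ∷ v) _ noConsecutive =
  gap (spaced⁺ (false ∷ v) (memℕ-zero v) (proj₂ (noConsecutive-∷⁻ (false ∷ v) noConsecutive)))
spaced⁺ (false ∷ true ∷ v) _ noConsecutive =
  let after-peak = noConsecutive-∷⁻ v (proj₂ (noConsecutive-∷⁻ (true ∷ v) noConsecutive))
  in peak (spaced⁺ v (proj₁ after-peak refl) (proj₂ after-peak))

peakSet⇒spaced : (v : Vec Bool n) → PeakSet (b ∷ v) → b ≡ false × Spaced v
peakSet⇒spaced {b = b} v (≥2 , noConsecutive) =
  ¬-not b≢true , spaced⁺ v (¬-not v₀≢true) (proj₂ (noConsecutive-∷⁻ v noConsecutive))
  where
  b≢true : b ≢ true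
  b≢true b≡true with () ← ≥2 0 (trans (memℕ-zero v) b≡true)
  v₀≢true : memℕ v 0 ≢ true
  v₀≢true v₀≡true with s≤s () ← ≥2 1 (trans (memℕ-suc v) v₀≡true)

spaced⇒peakSet : {v : Vec Bool n} → Spaced v → PeakSet (false ∷ v)
spaced⇒peakSet {v = v} s = ≥2 , noConsecutive-∷⁺ v (λ ()) (proj₂ (spaced⁻ s))
  where
  ≥2 : ∀ k → memℕ (false ∷ v) k ≡ true → 2 ≤ k
  ≥2 zero b≡true with () ← trans (sym (memℕ-zero v)) b≡true
  ≥2 (suc zero) v₀≡true with () ← trans (sym (proj₁ (spaced⁻ s))) (trans (sym (memℕ-suc v)) v₀≡true)
  ≥2 (suc (suc k)) _ = s≤s (s≤s z≤n)

oddFlags : Vec Bool n → List Bool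
oddFlags [] = false ∷ []
oddFlags (x ∷ v) = (not x ∧ not (memℕ v 0)) ∷ oddFlags v

oddFlags-gap : {v : Vec Bool n} → Spaced v → oddFlags (false ∷ v) ≡ true ∷ oddFlags v
oddFlags-gap {v = v} s = cong (λ v₀ → not v₀ ∷ oddFlags v) (proj₁ (spaced⁻ s))

oddFlags-peak : (v : Vec Bool n) → oddFlags (false ∷ true ∷ v) ≡ false ∷ false ∷ oddFlags v
oddFlags-peak v = cong (λ v₀ → not v₀ ∷ false ∷ oddFlags v) (memℕ-zero v)

oddFlags-oddCuts : {v : Vec Bool n} → Spaced v → OddCuts (oddFlags v)
oddFlags-oddCuts [] = end
oddFlags-oddCuts (gap s) = subst OddCuts (sym (oddFlags-gap s)) (cut (oddFlags-oddCuts s))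
oddFlags-oddCuts (peak {v = v} s) = subst OddCuts (sym (oddFlags-peak v)) (extend (oddFlags-oddCuts s))

oddFlags-injective : {v w : Vec Bool n} → Spaced v → Spaced w → oddFlags v ≡ oddFlags w → v ≡ w
oddFlags-injective [] [] _ = refl
oddFlags-injective (gap s) (gap t) eq =
  cong (false ∷_) (oddFlags-injective s t (∷-injectiveʳ (trans (sym (oddFlags-gap s)) (trans eq (oddFlags-gap t)))))
oddFlags-injective (peak {v = v} s) (peak {v = w} t) eq =
  cong (λ u → false ∷ true ∷ u) (oddFlags-injective s t
    (∷-injectiveʳ (∷-injectiveʳ (trans (sym (oddFlags-peak v)) (trans eq (oddFlags-peak w))))))
oddFlags-injective (gap s) (peak {v = w} _) eq
  with () ← ∷-injectiveˡ (trans (sym (oddFlags-gap s)) (trans eq (oddFlags-peak w)))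
oddFlags-injective (peak {v = v} _) (gap t) eq
  with () ← ∷-injectiveˡ (trans (sym (oddFlags-peak v)) (trans eq (oddFlags-gap t)))

oddFlags-surjective : ∀ {fs} → OddCuts fs → length fs ≡ suc m → ∃[ v ] Spaced {m} v × oddFlags v ≡ fs
oddFlags-surjective end refl = [] , [] , refl
oddFlags-surjective {suc m} (cut c) eq =
  let v , s , v↦fs = oddFlags-surjective c (ℕ.suc-injective eq)
  in false ∷ v , gap s , trans (oddFlags-gap s) (cong (true ∷_) v↦fs)
oddFlags-surjective {suc (suc m)} (extend c) eq =
  let v , s , v↦fs = oddFlags-surjective c (ℕ.suc-injective (ℕ.suc-injective eq))
  in false ∷ true ∷ v , peak s , trans (oddFlags-peak v) (cong (λ fs → false ∷ false ∷ fs) v↦fs)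
oddFlags-surjective {zero} (cut end) ()
oddFlags-surjective {zero} (cut (cut _)) ()
oddFlags-surjective {zero} (cut (extend _)) ()
oddFlags-surjective {zero} (extend _) ()
oddFlags-surjective {suc zero} (extend end) ()
oddFlags-surjective {suc zero} (extend (cut _)) ()
oddFlags-surjective {suc zero} (extend (extend _)) ()

flag : Subset n → Fin n → Bool
flag A p = memℕ A (suc (toℕ p))

flags : Subset n → List Bool
flags A = tabulate (flag A)

lookup-map-allFin : (f : Fin n → A) (i : Fin n) → Vec.lookup (Vec.map f (Vec.allFin n)) i ≡ f i
lookup-map-allFin f i = trans (Vec.lookup-map i f (Vec.allFin _)) (cong f (Vec.lookup-allFin i))

-- False at j = m: n ∉ Odd(B) although neither n nor n + 1 lies in B.
memℕ-OddSet : (v : Vec Bool m) {j : ℕ} → j ℕ.< m →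
              memℕ (OddSet (b ∷ v)) (suc j) ≡ (not (memℕ v j) ∧ not (memℕ v (suc j)))
memℕ-OddSet {b = b} v {j} j<m = begin
  memℕ (OddSet (b ∷ v)) (suc j)
    ≡⟨ memℕ-lookup (OddSet (b ∷ v)) (s≤s j<m) ⟩
  Vec.lookup (OddSet (b ∷ v)) (fromℕ< (s≤s j<m))
    ≡⟨ lookup-map-allFin _ (fromℕ< (s≤s j<m)) ⟩
  not (memℕ (b ∷ v) (suc (toℕ (fromℕ< j<m)))) ∧ not (memℕ (b ∷ v) (suc (suc (toℕ (fromℕ< j<m)))))
    ≡⟨ cong (λ i → not (memℕ (b ∷ v) (suc i)) ∧ not (memℕ (b ∷ v) (suc (suc i)))) (Fin.toℕ-fromℕ< j<m) ⟩
  not (memℕ (b ∷ v) (suc j)) ∧ not (memℕ (b ∷ v) (suc (suc j)))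
    ≡⟨ cong₂ (λ x y → not x ∧ not y) (memℕ-suc v) (memℕ-suc v) ⟩
  not (memℕ v j) ∧ not (memℕ v (suc j))
    ∎

tabulate-oddFlags : (v : Vec Bool m) (g : ℕ → Bool) →
                    (∀ {j} → j ℕ.< m → g j ≡ (not (memℕ v j) ∧ not (memℕ v (suc j)))) → g m ≡ false →
                    tabulate {n = suc m} (g ∘ toℕ) ≡ oddFlags v
tabulate-oddFlags [] g _ gₘ≡false = cong (_∷ []) gₘ≡false
tabulate-oddFlags (x ∷ v) g below gₘ≡false =
  cong₂ _∷_ (trans (below (s≤s z≤n)) (cong₂ notBoth (memℕ-zero v) (memℕ-suc v)))
    (tabulate-oddFlags v (g ∘ suc) (λ j<m → trans (below (s≤s j<m)) (cong₂ notBoth (memℕ-suc v) (memℕ-suc v)))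
      gₘ≡false)
  where
  notBoth : Bool → Bool → Bool
  notBoth x y = not x ∧ not y

flags-OddSet : (v : Vec Bool m) → flags (OddSet (b ∷ v)) ≡ oddFlags v
flags-OddSet {b = b} v =
  tabulate-oddFlags v (λ j → memℕ (OddSet (b ∷ v)) (suc j)) (memℕ-OddSet v) (memℕ-≥ (OddSet (b ∷ v)) ℕ.≤-refl)

-- SetComp as the blocks of a flagged word

labelled : Subset n → Permutation′ n → Fin n → Bool × Fin n
labelled A σ p = flag A p , σ ⟨$⟩ʳ p

flagged : Subset n → Permutation′ n → List (Bool × Fin n)
flagged A σ = tabulate (labelled A σ)

setCompGo-blocks : (A : Subset n) (σ : Permutation′ n) (ps : List (Fin n)) (cur : Subset n) →
  let bs = blocks (map (labelled A σ) ps) in setCompGo A σ ps cur ≡ addAll cur (head bs) ∷ map toSubset (tail bs)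
setCompGo-blocks A σ [] cur = refl
setCompGo-blocks A σ (p ∷ ps) cur with flag A p
... | true = cong (_ ∷_) (setCompGo-blocks A σ ps ⊥)
... | false = setCompGo-blocks A σ ps _

toList-tabulate : ∀ n (f : Fin n → A) → Vec.toList (Vec.tabulate f) ≡ tabulate f
toList-tabulate zero f = refl
toList-tabulate (suc n) f = cong (f zero ∷_) (toList-tabulate n (f ∘ suc))

SetComp-blocks : (A : Subset n) (σ : Permutation′ n) → SetComp A σ ≡ map toSubset (toList (blocks (flagged A σ)))
SetComp-blocks {n} A σ = begin
  setCompGo A σ (Vec.toList (Vec.allFin n)) ⊥
    ≡⟨ cong (λ ps → setCompGo A σ ps ⊥) (toList-tabulate n (λ i → i)) ⟩
  setCompGo A σ (allFin n) ⊥
    ≡⟨ setCompGo-blocks A σ (allFin n) ⊥ ⟩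
  map toSubset (toList (blocks (map (labelled A σ) (allFin n))))
    ≡⟨ cong (map toSubset ∘ toList ∘ blocks) (map-tabulate (λ i → i) (labelled A σ)) ⟩
  map toSubset (toList (blocks (flagged A σ)))
    ∎

map-proj₁-flagged : (A : Subset n) (σ : Permutation′ n) → map proj₁ (flagged A σ) ≡ flags A
map-proj₁-flagged A σ = map-tabulate (labelled A σ) proj₁

map-proj₂-flagged : (A : Subset n) (σ : Permutation′ n) → map proj₂ (flagged A σ) ≡ word σ
map-proj₂-flagged A σ = map-tabulate (labelled A σ) proj₂

map-proj-injective : {X Y : Set} (xs ys : List (X × Y)) →
                     map proj₁ xs ≡ map proj₁ ys → map proj₂ xs ≡ map proj₂ ys → xs ≡ ys
map-proj-injective [] [] _ _ = refl
map-proj-injective (_ ∷ xs) (_ ∷ ys) eq₁ eq₂ =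
  cong₂ _∷_ (cong₂ _,_ (∷-injectiveˡ eq₁) (∷-injectiveˡ eq₂))
            (map-proj-injective xs ys (∷-injectiveʳ eq₁) (∷-injectiveʳ eq₂))

desSubset⇒linked : (A : Subset n) (σ : Permutation′ n) → DesSubset σ A → Linked (WithinBlock _<_) (flagged A σ)
desSubset⇒linked A σ des = Linked-tabulate⁺ (labelled A σ) ascent
  where
  ascent : ∀ p q → toℕ q ≡ suc (toℕ p) → flag A p ≡ false → σ ⟨$⟩ʳ p < σ ⟨$⟩ʳ q
  ascent p q q≡p+1 no-cut with Fin.<-cmp (σ ⟨$⟩ʳ p) (σ ⟨$⟩ʳ q)
  ... | tri< σp<σq _ _ = σp<σq
  ... | tri≈ _ σp≡σq _ = ⊥-elim (ℕ.1+n≢n (sym (trans (cong toℕ (⟨$⟩ʳ-injective σ σp≡σq)) q≡p+1)))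
  ... | tri> _ _ σq<σp with () ← trans (sym (des p q q≡p+1 σq<σp)) no-cut

linked⇒desSubset : (A : Subset n) (σ : Permutation′ n) → Linked (WithinBlock _<_) (flagged A σ) → DesSubset σ A
linked⇒desSubset A σ linked p q q≡p+1 σq<σp =
  ¬-not λ no-cut → Fin.<-asym σq<σp (Linked-tabulate⁻ (labelled A σ) linked p q q≡p+1 no-cut)

flagged-oddCuts : (B : Subset (suc m)) (σ : Permutation′ (suc m)) → PeakSet B →
                  OddCuts (map proj₁ (flagged (OddSet B) σ))
flagged-oddCuts (b ∷ v) σ peakSet =
  subst OddCuts (sym (trans (map-proj₁-flagged (OddSet (b ∷ v)) σ) (flags-OddSet v)))
    (oddFlags-oddCuts (proj₂ (peakSet⇒spaced v peakSet)))

flagged-injective : (B B′ : Subset (suc m)) (σ σ′ : Permutation′ (suc m)) → PeakSet B → PeakSet B′ →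
                    flagged (OddSet B) σ ≡ flagged (OddSet B′) σ′ → B ≡ B′ × (∀ i → σ ⟨$⟩ʳ i ≡ σ′ ⟨$⟩ʳ i)
flagged-injective (b ∷ v) (b′ ∷ v′) σ σ′ peakSet peakSet′ eq
  with refl , spaced ← peakSet⇒spaced v peakSet | refl , spaced′ ← peakSet⇒spaced v′ peakSet′ =
  cong (false ∷_) (oddFlags-injective spaced spaced′ oddFlags≡) ,
  word-injective {σ = σ} {σ′} (trans (sym (map-proj₂-flagged _ σ)) (trans (cong (map proj₂) eq) (map-proj₂-flagged _ σ′)))
  where
  oddFlags≡ : oddFlags v ≡ oddFlags v′
  oddFlags≡ = begin
    oddFlags v                                   ≡⟨ sym (flags-OddSet v) ⟩
    flags (OddSet (false ∷ v))                   ≡⟨ sym (map-proj₁-flagged _ σ) ⟩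
    map proj₁ (flagged (OddSet (false ∷ v)) σ)   ≡⟨ cong (map proj₁) eq ⟩
    map proj₁ (flagged (OddSet (false ∷ v′)) σ′) ≡⟨ map-proj₁-flagged _ σ′ ⟩
    flags (OddSet (false ∷ v′))                  ≡⟨ flags-OddSet v′ ⟩
    oddFlags v′                                  ∎

flagged-surjective : (ps : List (Bool × Fin (suc m))) → OddCuts (map proj₁ ps) →
                     Unique (map proj₂ ps) → (∀ x → x ∈ₗ map proj₂ ps) →
                     ∃[ B ] ∃[ σ ] PeakSet B × flagged (OddSet B) σ ≡ ps
flagged-surjective ps oddCuts unique complete
  with v , spaced , v↦flags ← oddFlags-surjective oddCuts
         (trans (length-map proj₁ ps) (trans (sym (length-map proj₂ ps)) (length-enumeration _ unique complete)))
     | σ , σ↦word ← word-surjective (map proj₂ ps) unique complete =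
  false ∷ v , σ , spaced⇒peakSet spaced ,
  map-proj-injective _ ps (trans (map-proj₁-flagged _ σ) (trans (flags-OddSet v) v↦flags))
                          (trans (map-proj₂-flagged _ σ) σ↦word)

SetComp-isOddSetComposition : (B : Subset (suc m)) (σ : Permutation′ (suc m)) → PeakSet B →
                              IsOddSetComposition (SetComp (OddSet B) σ)
SetComp-isOddSetComposition B σ peakSet =
  subst IsOddSetComposition (sym (SetComp-blocks (OddSet B) σ))
    (toSubsets-isOddSetComposition (toList (blocks (flagged (OddSet B) σ)))
      (subst Unique (sym concat≡word) (word-unique σ))
      (λ x → subst (x ∈ₗ_) (sym concat≡word) (∈-word σ x))
      (blocks-odd (flagged (OddSet B) σ) (flagged-oddCuts B σ peakSet)))
  where
  concat≡word : concat (toList (blocks (flagged (OddSet B) σ))) ≡ word σ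
  concat≡word = trans (concat-blocks (flagged (OddSet B) σ)) (map-proj₂-flagged (OddSet B) σ)

SetComp-injective : (B B′ : Subset (suc m)) (σ σ′ : Permutation′ (suc m)) →
                    EnrichedStandard B σ → EnrichedStandard B′ σ′ →
                    SetComp (OddSet B) σ ≡ SetComp (OddSet B′) σ′ → B ≡ B′ × (∀ i → σ ⟨$⟩ʳ i ≡ σ′ ⟨$⟩ʳ i)
SetComp-injective B B′ σ σ′ (peakSet , des) (peakSet′ , des′) eq =
  flagged-injective B B′ σ σ′ peakSet peakSet′ (blocks-injective _ _
    (map-toSubset-injective (increasing (OddSet B) σ des) (increasing (OddSet B′) σ′ des′)
      (trans (sym (SetComp-blocks _ σ)) (trans eq (SetComp-blocks _ σ′)))))
  where
  increasing : ∀ A σ → DesSubset σ A → All (Linked _<_) (toList (blocks (flagged A σ)))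
  increasing A σ des = blocks-linked _ (desSubset⇒linked A σ des)

oddIncreasingBlocks-realised : (c : List (Fin (suc m))) (cs : List (List (Fin (suc m)))) →
  Unique (concat (c ∷ cs)) → (∀ x → x ∈ₗ concat (c ∷ cs)) → All Odd (c ∷ cs) → All (Linked _<_) (c ∷ cs) →
  ∃[ B ] ∃[ σ ] EnrichedStandard B σ × toList (blocks (flagged (OddSet B) σ)) ≡ c ∷ cs
oddIncreasingBlocks-realised c cs unique complete odds increasing
  with nonempty ← All.map odd⇒≢[] odds
  with B , σ , peakSet , flagged≡ps ← flagged-surjective (unblocks (c ∷ cs)) (unblocks-oddCuts c cs odds)
         (subst Unique (sym (map-proj₂-unblocks c cs nonempty)) unique)
         (λ x → subst (x ∈ₗ_) (sym (map-proj₂-unblocks c cs nonempty)) (complete x)) =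
  B , σ ,
  (peakSet , linked⇒desSubset (OddSet B) σ (subst (Linked _) (sym flagged≡ps) (unblocks-linked c cs increasing))) ,
  trans (cong (toList ∘ blocks) flagged≡ps) (cong toList (blocks-unblocks c cs nonempty))

SetComp-surjective : (Φ : List (Subset (suc m))) → IsOddSetComposition Φ →
                     ∃[ B ] ∃[ σ ] EnrichedStandard B σ × SetComp (OddSet B) σ ≡ Φ
SetComp-surjective [] isOddSetComposition
  with () ← proj₁ (proj₂ (elements-isOddSetComposition [] isOddSetComposition)) zero
SetComp-surjective (φ ∷ Φ) isOddSetComposition
  with unique , complete , odds ← elements-isOddSetComposition (φ ∷ Φ) isOddSetComposition
  with B , σ , enriched , blocks≡ ← oddIncreasingBlocks-realised (elements φ) (map elements Φ) unique complete odds
                                      (All.map⁺ (All.universal elements-increasing (φ ∷ Φ))) =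
  B , σ , enriched , (begin
    SetComp (OddSet B) σ                                   ≡⟨ SetComp-blocks (OddSet B) σ ⟩
    map toSubset (toList (blocks (flagged (OddSet B) σ)))  ≡⟨ cong (map toSubset) blocks≡ ⟩
    map toSubset (map elements (φ ∷ Φ))                    ≡⟨ map-toSubset-elements (φ ∷ Φ) ⟩
    φ ∷ Φ                                                  ∎)

proposition4p2 : (n : ℕ) → 1 ≤ n →
    ((B : Subset n) (σ : Permutation′ n) → EnrichedStandard B σ →
      IsOddSetComposition (SetComp (OddSet B) σ))
    × ((B B′ : Subset n) (σ σ′ : Permutation′ n) →
      EnrichedStandard B σ → EnrichedStandard B′ σ′ →
      SetComp (OddSet B) σ ≡ SetComp (OddSet B′) σ′ →
      B ≡ B′ × ((i : Fin n) → σ ⟨$⟩ʳ i ≡ σ′ ⟨$⟩ʳ i))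
    × ((Φ : List (Subset n)) → IsOddSetComposition Φ →
      ∃[ B ] ∃[ σ ] (EnrichedStandard B σ × SetComp (OddSet B) σ ≡ Φ))
proposition4p2 zero ()
proposition4p2 (suc m) _ =
  (λ B σ → SetComp-isOddSetComposition B σ ∘ proj₁) , SetComp-injective , SetComp-surjective
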